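{- The group of symmetries of the $2$-coloured operad $\mathrm{Bulle}$ is generated by the maps $\mathrm{Cpl}$ and $\mathrm{Ret}$, and these satisfy $\mathrm{Ret}=\mathrm{Ret}^{ -1}$, $\mathrm{Cpl}=\mathrm{Cpl}^{ -1}$ and $\mathrm{Ret}\,\mathrm{Cpl}=\mathrm{Cpl}\,\mathrm{Ret}$.
   Context: $\mathrm{Bulle}$ is the $2$-coloured (non-symmetric, set-theoretic) operad whose elements of arity $n\ge2$ are the bubbles, i.e. pairs $(c,w)$ with $c\in\{1,2\}$ (output colour) and $w=w_1\cdots w_n\in\{1,2\}^n$ (the $i$-th input colour being $w_i$), and whose elements of arity $1$ are units $\mathbb{1}_1,\mathbb{1}_2$ ($\mathbb{1}_c$ has output and input colour $c$). The composition $(c,u)\circ_i(d,v)$ is defined iff $u_i=d$ and then equals $(c,u_1\cdots u_{i-1}vu_{i+1}\cdots u_n)$. (Geometrically, a bubble is a polygon with vertices $1,\dots,n+1$ whose edges and base are each blue or uncoloured, with no coloured diagonals: $c=1$ iff the base is blue, and $w_i=2$ iff the $i$-th edge is blue.) A coloured operad automorphism of $\mathrm{Bulle}$ is an arity-preserving bijection $\phi$ such that whenever $x\circ_i y$ is defined, $\phi(x)\circ_i\phi(y)$ is defined and equals $\phi(x\circ_i y)$. A coloured operad antiautomorphism is an arity-preserving bijection $\phi$ such that whenever $x\circ_i y$ is defined, $\phi(x)\circ_{|x|-i+1}\phi(y)$ is defined and equals $\phi(x\circ_i y)$. A symmetry is an automorphism or an antiautomorphism; symmetries form a group under composition. The complementary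 map is $\mathrm{Cpl}(c,w_1\cdots w_n)=(3-c,(3-w_1)\cdots(3-w_n))$, i.e. all edge colours of the bubble are swapped, with $\mathrm{Cpl}(\mathbb{1}_c)=\mathbb{1}_{3-c}$. The returned map is $\mathrm{Ret}(c,w_1\cdots w_n)=(c,w_n\cdots w_1)$, i.e. the reflection through the vertical line passing through the middle of the base, with $\mathrm{Ret}(\mathbb{1}_c)=\mathbb{1}_c$. -}

module Defs where

open import Data.Nat using (ℕ; zero; suc)
open import Data.Fin using (Fin; toℕ; opposite)
open import Data.Vec using (Vec; toList; reverse; _∷_; [])
import Data.Vec as Vec
open import Data.List using (List; take; drop; _++_; [] ; _∷_; foldr)
import Data.List as List
open import Data.Product using (_×_; Σ; ∃)
open import Data.Sum using (_⊎_)
open import Function.Definitions using (Bijective)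
open import Relation.Binary.PropositionalEquality using (_≡_)

data Colour : Set where
  c1 c2 : Colour

swapC : Colour → Colour
swapC c1 = c2
swapC c2 = c1

data Bulle : ℕ → Set where
  unit : Colour → Bulle 1
  bub  : ∀ {n} → Colour → Vec Colour (suc (suc n)) → Bulle (suc (suc n))

out : ∀ {n} → Bulle n → Colour
out (unit c)  = c
out (bub c w) = c

ins : ∀ {n} → Bulle n → Vec Colour n
ins (unit c)  = c ∷ []
ins (bub c w) = w

substAt : ∀ {A : Set} → List A → ℕ → List A → List A
substAt xs i ys = take i xs ++ ys ++ drop (suc i) xs

-- IsComp x i y z : x ∘_i y is defined and equals z  (i is 0-based)
IsComp : ∀ {m n k} → Bulle m → Fin m → Bulle n → Bulle k → Set
IsComp x i y z =
  (Vec.lookup (ins x) i ≡ out y) ×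
  (out z ≡ out x) ×
  (toList (ins z) ≡ substAt (toList (ins x)) (toℕ i) (toList (ins y)))

Map : Set
Map = ∀ {n} → Bulle n → Bulle n

IsBijection : Map → Set
IsBijection φ = ∀ n → Bijective _≡_ _≡_ (φ {n})

IsAutomorphism : Map → Set
IsAutomorphism φ = IsBijection φ ×
  (∀ {m n k} (x : Bulle m) (i : Fin m) (y : Bulle n) (z : Bulle k) →
     IsComp x i y z → IsComp (φ x) i (φ y) (φ z))

-- opposite i is the 0-based version of |x| - i + 1
IsAntiautomorphism : Map → Set
IsAntiautomorphism φ = IsBijection φ ×
  (∀ {m n k} (x : Bulle m) (i : Fin m) (y : Bulle n) (z : Bulle k) →
     IsComp x i y z → IsComp (φ x) (opposite i) (φ y) (φ z))

IsSymmetry : Map → Set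
IsSymmetry φ = IsAutomorphism φ ⊎ IsAntiautomorphism φ

Cpl : Map
Cpl (unit c)  = unit (swapC c)
Cpl (bub c w) = bub (swapC c) (Vec.map swapC w)

Ret : Map
Ret (unit c)  = unit c
Ret (bub c w) = bub c (reverse w)

idMap : Map
idMap x = x

_∘M_ : Map → Map → Map
(f ∘M g) x = f (g x)

data Gen : Set where
  gCpl gRet : Gen

genMap : Gen → Map
genMap gCpl = Cpl
genMap gRet = Ret

evalWord : List Gen → Map
evalWord List.[] = idMap
evalWord (g List.∷ gs) = genMap g ∘M evalWord gs

_≗M_ : Map → Map → Set
f ≗M g = ∀ {n} (x : Bulle n) → f x ≡ g x

-- A symmetry is determined by what it does to the units: composing a unit on the
-- left of x recovers the output colour of x, and composing units on the right
-- recovers its input colours. So an automorphism recolours every bubble by the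
-- map σ it induces on the colours of the units; σ is a permutation of the two
-- colours, hence the automorphism is the identity or Cpl. An antiautomorphism
-- followed by Ret is an automorphism, which leaves Ret and Ret ∘ Cpl.
module Submission where

open import Defs
open import Data.List using (List)
open import Data.Product using (_×_; ∃)

open import Data.Nat using (ℕ; suc)
open import Data.Fin using (Fin; toℕ; opposite; fromℕ; inject₁)
import Data.Fin as F
open import Data.Fin.Properties using (opposite-involutive; toℕ-fromℕ; toℕ-inject₁)
open import Data.Vec using (Vec; lookup; toList; reverse; _∷ʳ_)
import Data.Vec as V
open import Data.Vec.Properties
  using (tabulate∘lookup; tabulate-cong; lookup-map; map-reverse; toList-map; toList-reverse;
         map-id; map-cong; map-∘; reverse-∷; reverse-involutive; length-toList)
import Data.List as L
open import Data.List using (take; drop; _++_; length)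
open import Data.List.Properties
  using (map-++; take-map; drop-map; ++-assoc; ++-identityʳ; reverse-++; length-reverse)
open import Data.Product using (_,_; proj₁; ∃₂)
open import Data.Sum using (inj₁; inj₂; _⊎_)
open import Data.Empty using (⊥-elim)
open import Function using (id)
open import Function.Definitions using (Injective)
import Function.Construct.Composition as Composition
open import Function.Consequences.Propositional
  using (inverseᵇ⇒bijective; strictlyInverseˡ⇒inverseˡ; strictlyInverseʳ⇒inverseʳ)
open import Relation.Binary.PropositionalEquality

private
  variable
    A B : Set
    m : ℕ

lookup-extensional : (u v : Vec A m) → (∀ i → lookup u i ≡ lookup v i) → u ≡ v
lookup-extensional u v p = trans (sym (tabulate∘lookup u)) (trans (tabulate-cong p) (tabulate∘lookup v))

lookup-∷ʳ-inject₁ : (xs : Vec A m) (x : A) (i : Fin m) →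
  lookup (xs ∷ʳ x) (inject₁ i) ≡ lookup xs i
lookup-∷ʳ-inject₁ (y V.∷ xs) x F.zero    = refl
lookup-∷ʳ-inject₁ (y V.∷ xs) x (F.suc i) = lookup-∷ʳ-inject₁ xs x i

lookup-∷ʳ-last : (xs : Vec A m) (x : A) → lookup (xs ∷ʳ x) (fromℕ m) ≡ x
lookup-∷ʳ-last V.[]        x = refl
lookup-∷ʳ-last (y V.∷ xs) x = lookup-∷ʳ-last xs x

lookup-reverse-opposite : (v : Vec A m) (i : Fin m) → lookup (reverse v) (opposite i) ≡ lookup v i
lookup-reverse-opposite {m = suc m} (x V.∷ xs) F.zero =
  trans (cong (λ u → lookup u (fromℕ m)) (reverse-∷ x xs)) (lookup-∷ʳ-last (reverse xs) x)
lookup-reverse-opposite (x V.∷ xs) (F.suc i) =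
  trans (cong (λ u → lookup u (inject₁ (opposite i))) (reverse-∷ x xs))
    (trans (lookup-∷ʳ-inject₁ (reverse xs) x (opposite i)) (lookup-reverse-opposite xs i))

toList-splitAt : (v : Vec A m) (i : Fin m) → ∃₂ λ xs ys →
  toList v ≡ xs ++ lookup v i L.∷ ys × length xs ≡ toℕ i × length ys ≡ toℕ (opposite i)
toList-splitAt (x V.∷ v) F.zero =
  L.[] , toList v , refl , refl , trans (length-toList v) (sym (toℕ-fromℕ _))
toList-splitAt (x V.∷ v) (F.suc i) with toList-splitAt v i
... | xs , ys , split , length-xs , length-ys =
  x L.∷ xs , ys , cong (x L.∷_) split , cong suc length-xs ,
  trans length-ys (sym (toℕ-inject₁ (opposite i)))

substAt-++-∷ : (xs : List A) (a : A) (ys zs : List A) →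
  substAt (xs ++ a L.∷ ys) (length xs) zs ≡ xs ++ zs ++ ys
substAt-++-∷ L.[]        a ys zs = refl
substAt-++-∷ (x L.∷ xs) a ys zs = cong (x L.∷_) (substAt-++-∷ xs a ys zs)

substAt-split : ∀ {ws : List A} {k} xs a ys zs → ws ≡ xs ++ a L.∷ ys → length xs ≡ k →
  substAt ws k zs ≡ xs ++ zs ++ ys
substAt-split xs a ys zs refl refl = substAt-++-∷ xs a ys zs

substAt-map : (f : A → B) (ws : List A) (k : ℕ) (zs : List A) →
  L.map f (substAt ws k zs) ≡ substAt (L.map f ws) k (L.map f zs)
substAt-map f ws k zs = begin
    L.map f (take k ws ++ zs ++ drop (suc k) ws)
  ≡⟨ map-++ f (take k ws) _ ⟩
    L.map f (take k ws) ++ L.map f (zs ++ drop (suc k) ws)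
  ≡⟨ cong (L.map f (take k ws) ++_) (map-++ f zs _) ⟩
    L.map f (take k ws) ++ L.map f zs ++ L.map f (drop (suc k) ws)
  ≡⟨ cong₂ (λ l r → l ++ L.map f zs ++ r) (sym (take-map k ws)) (sym (drop-map (suc k) ws)) ⟩
    take k (L.map f ws) ++ L.map f zs ++ drop (suc k) (L.map f ws)
  ∎
  where open ≡-Reasoning

reverse-++-++ : (xs zs ys : List A) →
  L.reverse (xs ++ zs ++ ys) ≡ L.reverse ys ++ L.reverse zs ++ L.reverse xs
reverse-++-++ xs zs ys = begin
    L.reverse (xs ++ zs ++ ys)
  ≡⟨ reverse-++ xs (zs ++ ys) ⟩
    L.reverse (zs ++ ys) ++ L.reverse xs
  ≡⟨ cong (_++ L.reverse xs) (reverse-++ zs ys) ⟩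
    (L.reverse ys ++ L.reverse zs) ++ L.reverse xs
  ≡⟨ ++-assoc (L.reverse ys) _ _ ⟩
    L.reverse ys ++ L.reverse zs ++ L.reverse xs
  ∎
  where open ≡-Reasoning

substAt-reverse : (v : Vec A m) (i : Fin m) (zs : List A) →
  L.reverse (substAt (toList v) (toℕ i) zs) ≡
  substAt (L.reverse (toList v)) (toℕ (opposite i)) (L.reverse zs)
substAt-reverse v i zs with toList-splitAt v i
... | xs , ys , split , length-xs , length-ys = begin
    L.reverse (substAt (toList v) (toℕ i) zs)
  ≡⟨ cong L.reverse (substAt-split xs a ys zs split length-xs) ⟩
    L.reverse (xs ++ zs ++ ys)
  ≡⟨ reverse-++-++ xs zs ys ⟩
    L.reverse ys ++ L.reverse zs ++ L.reverse xs
  ≡⟨ substAt-split (L.reverse ys) a (L.reverse xs) (L.reverse zs) reversed-split length-reverse-ys ⟨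
    substAt (L.reverse (toList v)) (toℕ (opposite i)) (L.reverse zs)
  ∎
  where
  open ≡-Reasoning
  a = lookup v i
  reversed-split : L.reverse (toList v) ≡ L.reverse ys ++ a L.∷ L.reverse xs
  reversed-split = trans (cong L.reverse split) (reverse-++-++ xs (a L.∷ L.[]) ys)
  length-reverse-ys : length (L.reverse ys) ≡ toℕ (opposite i)
  length-reverse-ys = trans (length-reverse ys) length-ys

Bulle-≡ : ∀ {n} {a b : Bulle n} → out a ≡ out b → ins a ≡ ins b → a ≡ b
Bulle-≡ {a = unit c}  {unit .c}   refl _    = refl
Bulle-≡ {a = bub c w} {bub .c .w} refl refl = refl

unit-η : (u : Bulle 1) → u ≡ unit (out u)
unit-η (unit c) = refl

lookup-ins-unit : (u : Bulle 1) → lookup (ins u) F.zero ≡ out u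
lookup-ins-unit (unit c) = refl

unit-identityˡ : ∀ {n} (x : Bulle n) → IsComp (unit (out x)) F.zero x x
unit-identityˡ x = refl , refl , sym (++-identityʳ _)

unit-identityʳ : ∀ {n} (x : Bulle n) (i : Fin n) → IsComp x i (unit (lookup (ins x) i)) x
unit-identityʳ x i with toList-splitAt (ins x) i
... | xs , ys , split , length-xs , _ =
  refl , refl , trans split (sym (substAt-split xs _ ys _ split length-xs))

Respects : Map → Set
Respects φ = ∀ {m n k} (x : Bulle m) (i : Fin m) (y : Bulle n) (z : Bulle k) →
  IsComp x i y z → IsComp (φ x) i (φ y) (φ z)

Reverses : Map → Set
Reverses φ = ∀ {m n k} (x : Bulle m) (i : Fin m) (y : Bulle n) (z : Bulle k) →
  IsComp x i y z → IsComp (φ x) (opposite i) (φ y) (φ z)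

Reverses∘Reverses⇒Respects : {φ ψ : Map} → Reverses φ → Reverses ψ → Respects (φ ∘M ψ)
Reverses∘Reverses⇒Respects {φ} {ψ} φ-rev ψ-rev x i y z x∘y≡z =
  subst (λ j → IsComp (φ (ψ x)) j (φ (ψ y)) (φ (ψ z))) (opposite-involutive i)
    (φ-rev (ψ x) (opposite i) (ψ y) (ψ z) (ψ-rev x i y z x∘y≡z))

Recolours : (Colour → Colour) → Map → Set
Recolours s φ = (∀ {n} (x : Bulle n) → out (φ x) ≡ s (out x))
              × (∀ {n} (x : Bulle n) → ins (φ x) ≡ V.map s (ins x))

colourMap : Map → Colour → Colour
colourMap φ c = out (φ (unit c))

Respects⇒Recolours : {φ : Map} → Respects φ → Recolours (colourMap φ) φ
Respects⇒Recolours {φ} φ-resp = out-φ , ins-φ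
  where
  out-φ : ∀ {n} (x : Bulle n) → out (φ x) ≡ colourMap φ (out x)
  out-φ x = trans (sym (proj₁ (φ-resp _ F.zero x x (unit-identityˡ x))))
                  (lookup-ins-unit (φ (unit (out x))))
  ins-φ : ∀ {n} (x : Bulle n) → ins (φ x) ≡ V.map (colourMap φ) (ins x)
  ins-φ x = lookup-extensional _ _ λ i →
    trans (proj₁ (φ-resp x i _ x (unit-identityʳ x i))) (sym (lookup-map i (colourMap φ) (ins x)))

Recolours⇒Respects : ∀ {s} {φ : Map} → Recolours s φ → Respects φ
Recolours⇒Respects {s} {φ} (out-φ , ins-φ) x i y z (lookup≡out , out≡out , toList≡substAt) =
    (begin
      lookup (ins (φ x)) i        ≡⟨ cong (λ w → lookup w i) (ins-φ x) ⟩
      lookup (V.map s (ins x)) i  ≡⟨ lookup-map i s (ins x) ⟩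
      s (lookup (ins x) i)        ≡⟨ cong s lookup≡out ⟩
      s (out y)                   ≡⟨ out-φ y ⟨
      out (φ y)                   ∎)
  , trans (out-φ z) (trans (cong s out≡out) (sym (out-φ x)))
  , (begin
      toList (ins (φ z))
    ≡⟨ toList-ins z ⟩
      L.map s (toList (ins z))
    ≡⟨ cong (L.map s) toList≡substAt ⟩
      L.map s (substAt (toList (ins x)) (toℕ i) (toList (ins y)))
    ≡⟨ substAt-map s (toList (ins x)) (toℕ i) _ ⟩
      substAt (L.map s (toList (ins x))) (toℕ i) (L.map s (toList (ins y)))
    ≡⟨ cong₂ (λ l r → substAt l (toℕ i) r) (toList-ins x) (toList-ins y) ⟨
      substAt (toList (ins (φ x))) (toℕ i) (toList (ins (φ y)))
    ∎)
  where
  open ≡-Reasoning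
  toList-ins : ∀ {n} (w : Bulle n) → toList (ins (φ w)) ≡ L.map s (toList (ins w))
  toList-ins w = trans (cong toList (ins-φ w)) (toList-map s (ins w))

Recolours-unique : ∀ {s t} {φ ψ : Map} →
  Recolours s φ → Recolours t ψ → (∀ c → s c ≡ t c) → φ ≗M ψ
Recolours-unique (out-φ , ins-φ) (out-ψ , ins-ψ) s≗t x =
  Bulle-≡ (trans (out-φ x) (trans (s≗t (out x)) (sym (out-ψ x))))
          (trans (ins-φ x) (trans (map-cong s≗t (ins x)) (sym (ins-ψ x))))

Recolours-idMap : Recolours id idMap
Recolours-idMap = (λ x → refl) , (λ x → sym (map-id (ins x)))

Recolours-Cpl : Recolours swapC Cpl
Recolours-Cpl = out-Cpl , ins-Cpl
  where
  out-Cpl : ∀ {n} (x : Bulle n) → out (Cpl x) ≡ swapC (out x)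
  out-Cpl (unit c)  = refl
  out-Cpl (bub c w) = refl
  ins-Cpl : ∀ {n} (x : Bulle n) → ins (Cpl x) ≡ V.map swapC (ins x)
  ins-Cpl (unit c)  = refl
  ins-Cpl (bub c w) = refl

colourMap-distinct : (φ : Map) → Injective _≡_ _≡_ (φ {1}) → colourMap φ c1 ≢ colourMap φ c2
colourMap-distinct φ φ-inj e with φ-inj (trans (unit-η _) (trans (cong unit e) (sym (unit-η _))))
... | ()

colour-permutation : (s : Colour → Colour) → s c1 ≢ s c2 →
  (∀ c → s c ≡ c) ⊎ (∀ c → s c ≡ swapC c)
colour-permutation s s-distinct with s c1 in e1 | s c2 in e2
... | c1 | c1 = ⊥-elim (s-distinct refl)
... | c2 | c2 = ⊥-elim (s-distinct refl)
... | c1 | c2 = inj₁ λ { c1 → e1 ; c2 → e2 }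
... | c2 | c1 = inj₂ λ { c1 → e1 ; c2 → e2 }

automorphism-word : (φ : Map) → Respects φ → Injective _≡_ _≡_ (φ {1}) →
  ∃ λ (ws : List Gen) → φ ≗M evalWord ws
automorphism-word φ φ-resp φ-inj
  with colour-permutation (colourMap φ) (colourMap-distinct φ φ-inj)
... | inj₁ σ≗id =
  L.[] , Recolours-unique {φ = φ} {idMap} (Respects⇒Recolours {φ} φ-resp) Recolours-idMap σ≗id
... | inj₂ σ≗swapC =
  gCpl L.∷ L.[] , Recolours-unique {φ = φ} {Cpl} (Respects⇒Recolours {φ} φ-resp) Recolours-Cpl σ≗swapC

swapC-involutive : ∀ c → swapC (swapC c) ≡ c
swapC-involutive c1 = refl
swapC-involutive c2 = refl

Cpl-involutive : (Cpl ∘M Cpl) ≗M idMap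
Cpl-involutive (unit c)  = cong unit (swapC-involutive c)
Cpl-involutive (bub c w) = cong₂ bub (swapC-involutive c)
  (trans (sym (map-∘ swapC swapC w)) (trans (map-cong swapC-involutive w) (map-id w)))

Ret-involutive : (Ret ∘M Ret) ≗M idMap
Ret-involutive (unit c)  = refl
Ret-involutive (bub c w) = cong (bub c) (reverse-involutive w)

Ret-Cpl-commute : (Ret ∘M Cpl) ≗M (Cpl ∘M Ret)
Ret-Cpl-commute (unit c)  = refl
Ret-Cpl-commute (bub c w) = cong (bub (swapC c)) (sym (map-reverse swapC w))

involution⇒bijection : (f : Map) → (f ∘M f) ≗M idMap → IsBijection f
involution⇒bijection f f∘f≗id n = inverseᵇ⇒bijective
  (strictlyInverseˡ⇒inverseˡ f f∘f≗id , strictlyInverseʳ⇒inverseʳ f f∘f≗id)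

Ret-reverses : Reverses Ret
Ret-reverses x i y z (lookup≡out , out≡out , toList≡substAt) =
    (begin
      lookup (ins (Ret x)) (opposite i)      ≡⟨ cong (λ w → lookup w (opposite i)) (ins-Ret x) ⟩
      lookup (reverse (ins x)) (opposite i)  ≡⟨ lookup-reverse-opposite (ins x) i ⟩
      lookup (ins x) i                       ≡⟨ lookup≡out ⟩
      out y                                  ≡⟨ out-Ret y ⟨
      out (Ret y)                            ∎)
  , trans (out-Ret z) (trans out≡out (sym (out-Ret x)))
  , (begin
      toList (ins (Ret z))
    ≡⟨ toList-ins z ⟩
      L.reverse (toList (ins z))
    ≡⟨ cong L.reverse toList≡substAt ⟩
      L.reverse (substAt (toList (ins x)) (toℕ i) (toList (ins y)))
    ≡⟨ substAt-reverse (ins x) i _ ⟩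
      substAt (L.reverse (toList (ins x))) (toℕ (opposite i)) (L.reverse (toList (ins y)))
    ≡⟨ cong₂ (λ l r → substAt l (toℕ (opposite i)) r) (toList-ins x) (toList-ins y) ⟨
      substAt (toList (ins (Ret x))) (toℕ (opposite i)) (toList (ins (Ret y)))
    ∎)
  where
  open ≡-Reasoning
  out-Ret : ∀ {n} (w : Bulle n) → out (Ret w) ≡ out w
  out-Ret (unit c)  = refl
  out-Ret (bub c w) = refl
  ins-Ret : ∀ {n} (w : Bulle n) → ins (Ret w) ≡ reverse (ins w)
  ins-Ret (unit c)  = refl
  ins-Ret (bub c w) = refl
  toList-ins : ∀ {n} (w : Bulle n) → toList (ins (Ret w)) ≡ L.reverse (toList (ins w))
  toList-ins w = trans (cong toList (ins-Ret w)) (toList-reverse (ins w))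

symmetry-word : (φ : Map) → IsSymmetry φ → ∃ λ (ws : List Gen) → φ ≗M evalWord ws
symmetry-word φ (inj₁ (φ-bij , φ-resp)) = automorphism-word φ φ-resp (proj₁ (φ-bij 1))
symmetry-word φ (inj₂ (φ-bij , φ-rev)) =
  let ws , Ret∘φ≗ws = automorphism-word (Ret ∘M φ) Ret∘φ-respects Ret∘φ-injective
  in gRet L.∷ ws , λ x → trans (sym (Ret-involutive (φ x))) (cong Ret (Ret∘φ≗ws x))
  where
  Ret∘φ-respects : Respects (Ret ∘M φ)
  Ret∘φ-respects = Reverses∘Reverses⇒Respects {Ret} {φ} Ret-reverses φ-rev
  Ret∘φ-injective : Injective _≡_ _≡_ ((Ret ∘M φ) {1})
  Ret∘φ-injective = Composition.injective _≡_ _≡_ _≡_ {f = φ} {g = Ret}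
    (proj₁ (φ-bij 1)) (proj₁ (involution⇒bijection Ret Ret-involutive 1))

mainTheorem7 : IsSymmetry Cpl × IsSymmetry Ret
    × (∀ (φ : Map) → IsSymmetry φ → ∃ λ (ws : List Gen) → φ ≗M evalWord ws)
    × ((Ret ∘M Ret) ≗M idMap) × ((Cpl ∘M Cpl) ≗M idMap)
    × ((Ret ∘M Cpl) ≗M (Cpl ∘M Ret))
mainTheorem7 =
    inj₁ (involution⇒bijection Cpl Cpl-involutive , Recolours⇒Respects {φ = Cpl} Recolours-Cpl)
  , inj₂ (involution⇒bijection Ret Ret-involutive , Ret-reverses)
  , symmetry-word
  , Ret-involutive , Cpl-involutive , Ret-Cpl-commute
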